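{- Let $G=(A,B,E)$ be a bipartite graph and let $A'\subseteq A$ be nonempty with $|\Gamma(A')|\le|A'|$. If for all nonempty $A''\subseteq A'$ we have $\frac{|\Gamma(A'')|}{|A''|}\ge\frac{|\Gamma(A')|}{|A'|}$, then $$\operatorname{deg}_{\max}\mathrm{semi}(A',B,E)\le\Big\lceil\frac{|A'|}{|\Gamma(A')|}\Big\rceil.$$
   Context: $\Gamma(X)$ is the set of neighbors in $G$ of vertices of $X$. $\deg_F(v)$ is the number of edges of $F$ at $v$; $\operatorname{deg}_{\max}F=\max_v\deg_F(v)$. For $A'\subseteq A$, a semi-matching of $(A',B,E)$ is a set $S$ of edges of $E$ between $A'$ and $B$ with $\deg_S(a)=1$ for all $a\in A'$. A degree-minimizing path with respect to $S$ is a path $b_1,a_1,b_2,\dots,a_{k-1},b_k$ ($a_i\in A'$) with $(a_i,b_i)\in S$, $(a_i,b_{i+1})\in E\setminus S$, $\deg_S(b_1)\ge\deg_S(b_k)+2$; $\mathrm{semi}(A',B,E)$ denotes an optimal semi-matching, i.e. one with no degree-minimizing path (all optimal ones have the same, minimum possible, maximum degree). The notation presupposes every vertex of $A'$ has a neighbor. -}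

module Defs where

open import Data.Nat using (ℕ; zero; suc; _+_; _*_; _≤_; _⊔_)
open import Data.Nat.DivMod using (_/_)
open import Data.Bool using (Bool; true; false; _∧_; _∨_)
open import Data.Fin using (Fin; zero; suc; inject₁; fromℕ)
open import Data.Fin.Subset using (Subset; _∈_; _⊆_; Nonempty; ∣_∣)
open import Data.Vec using (tabulate; lookup)
open import Data.List using (List; foldr; map; allFin)
open import Data.Empty using (⊥)
open import Data.Product using (Σ; _×_)
open import Function.Definitions using (Injective)
open import Relation.Binary.PropositionalEquality using (_≡_)

-- A bipartite graph G = (A, B, E) with A = Fin m, B = Fin n and
-- E given by its (Boolean) bipartite adjacency: E a b ≡ true iff (a,b) ∈ E.
BipGraph : ℕ → ℕ → Set
BipGraph m n = Fin m → Fin n → Bool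

EdgeSet : ℕ → ℕ → Set
EdgeSet m n = Fin m → Fin n → Bool

anyFin : {k : ℕ} → (Fin k → Bool) → Bool
anyFin {zero}  f = false
anyFin {suc k} f = f zero ∨ anyFin (λ i → f (suc i))

Γ : {m n : ℕ} → BipGraph m n → Subset m → Subset n
Γ E X = tabulate (λ b → anyFin (λ a → lookup X a ∧ E a b))

degA : {m n : ℕ} → EdgeSet m n → Fin m → ℕ
degA F a = ∣ tabulate (λ b → F a b) ∣

degB : {m n : ℕ} → EdgeSet m n → Fin n → ℕ
degB F b = ∣ tabulate (λ a → F a b) ∣

maxList : List ℕ → ℕ
maxList = foldr _⊔_ 0

degMax : {m n : ℕ} → EdgeSet m n → ℕ
degMax {m} {n} F = maxList (map (degA F) (allFin m)) ⊔ maxList (map (degB F) (allFin n))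

IsSemiMatching : {m n : ℕ} → BipGraph m n → Subset m → EdgeSet m n → Set
IsSemiMatching {m} {n} E A' S =
    ((a : Fin m) (b : Fin n) → S a b ≡ true → E a b ≡ true)
  × ((a : Fin m) (b : Fin n) → S a b ≡ true → a ∈ A')
  × ((a : Fin m) → a ∈ A' → degA S a ≡ 1)

-- A degree-minimizing path w.r.t. S:  b_1, a_1, b_2, …, a_{k-1}, b_k
-- (here k = suc l, bs indexes b_1 … b_k, as indexes a_1 … a_{k-1}),
-- a path (all vertices distinct), a_i ∈ A', (a_i,b_i) ∈ S,
-- (a_i,b_{i+1}) ∈ E ∖ S, and deg_S(b_1) ≥ deg_S(b_k) + 2.
record DegMinPath {m n : ℕ} (E : BipGraph m n) (A' : Subset m) (S : EdgeSet m n) : Set where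
  field
    l    : ℕ
    bs   : Fin (suc l) → Fin n
    as   : Fin l → Fin m
    bs-inj : Injective _≡_ _≡_ bs
    as-inj : Injective _≡_ _≡_ as
    as∈A'  : (i : Fin l) → as i ∈ A'
    inS    : (i : Fin l) → S (as i) (bs (inject₁ i)) ≡ true
    inE    : (i : Fin l) → E (as i) (bs (suc i)) ≡ true
    notS   : (i : Fin l) → S (as i) (bs (suc i)) ≡ false
    degGap : degB S (bs (fromℕ l)) + 2 ≤ degB S (bs zero)

IsOptimalSemiMatching : {m n : ℕ} → BipGraph m n → Subset m → EdgeSet m n → Set
IsOptimalSemiMatching E A' S = IsSemiMatching E A' S × (DegMinPath E A' S → ⊥)

-- Ceiling division ⌈ a / g ⌉ (the value at g = 0 is an arbitrary convention;
-- it never matters).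
⌈_/_⌉ : ℕ → ℕ → ℕ
⌈ a / zero ⌉  = 0
⌈ a / suc k ⌉ = (a + k) / suc k

-- Take b with deg_S b = d + 1 and let R be the set of vertices of B reachable from b by
-- alternating paths (an S-edge back into A', then an edge of E ∖ S forward), and A'' = S⁻¹(R).
-- R is closed under such steps, so Γ(A'') ⊆ R. By optimality no vertex of R has degree below d,
-- hence |A''| = Σ_{t ∈ R} deg_S t ≥ |R| d + 1. The hypothesis on A'' then gives
-- |Γ(A')| (|R| d + 1) ≤ |Γ(A'')| |A'| ≤ |R| |A'|, so |Γ(A')| d < |A'|, i.e. d + 1 ≤ ⌈|A'| / |Γ(A')|⌉.
-- R is built by adding one vertex outside R at a time, which keeps every alternating path simple.
module Submission where

open import Defs
open import Data.Nat using (ℕ; _*_; _≤_)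
open import Data.Fin.Subset using (Subset; _⊆_; Nonempty; ∣_∣)

open import Data.Bool using (Bool; true; false; _∧_)
import Data.Bool.Properties as Bool
open import Data.Bool.Properties using (∧-conicalˡ; ∧-conicalʳ; ¬-not)
open import Data.Fin using (Fin; zero; suc; inject₁; fromℕ)
import Data.Fin.Properties as Fin
open import Data.Fin.Properties using (any?)
open import Data.Fin.Relation.Unary.Top using (view; ‵fromℕ; ‵inject₁)
open import Data.Fin.Subset using (_∈_; _∉_; _∪_; _⊂_; _⊃_; Empty; inside; outside; ⁅_⁆)
open import Data.Fin.Subset.Induction using (⊃-wellFounded)
open import Data.Fin.Subset.Properties
  using (_∈?_; nonempty?; p⊆q⇒∣p∣≤∣q∣; ∣⁅x⁆∣≡1; ∣⊥∣≡0; Empty-unique; x∈⁅x⁆; x∈⁅y⁆⇒x≡y;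
         x∈p∧x≢y⇒x∈p-y; x∈p⇒∣p-x∣<∣p∣; x∈p∪q⁻; p⊆p∪q; q⊆p∪q)
open import Data.List using (List; []; _∷_; map; allFin)
open import Data.Nat using (zero; suc; _+_; _<_; z≤n; s≤s; s≤s⁻¹)
open import Data.Nat.DivMod using (_/_; m*n/n≡m; /-monoˡ-≤)
open import Data.Nat.Properties
open import Algebra.Properties.CommutativeSemigroup *-commutativeSemigroup using (x∙yz≈y∙xz)
open import Algebra.Properties.Semiring.Sum +-*-semiring
  using (sum; sum-syntax; sum-cong-≗; ∑-comm; *-distribʳ-sum)
open import Data.Product using (Σ-syntax; ∃-syntax; _,_; _×_; proj₁; proj₂)
open import Data.Sum using (inj₁; inj₂)
open import Data.Vec using ([]; _∷_; tabulate; lookup)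
open import Data.Vec.Functional using (Vector)
open import Data.Vec.Properties using (lookup∘tabulate; []=⇒lookup; lookup⇒[]=)
open import Function using (_∘_; id)
open import Function.Definitions using (Injective)
open import Induction.WellFounded using (Acc; acc)
open import Relation.Binary.PropositionalEquality
open import Relation.Nullary using (Dec; yes; no; ¬_; ¬?; _×-dec_; contradiction)
open import Relation.Nullary.Decidable using (decidable-stable)

χ : Bool → ℕ
χ false = 0
χ true  = 1

∣p∣≡∑χ : ∀ {n} (p : Subset n) → ∣ p ∣ ≡ ∑[ i < n ] χ (lookup p i)
∣p∣≡∑χ []            = refl
∣p∣≡∑χ (outside ∷ p) = ∣p∣≡∑χ p
∣p∣≡∑χ (inside  ∷ p) = cong suc (∣p∣≡∑χ p)

∣tabulate∣≡∑χ : ∀ {n} (f : Fin n → Bool) → ∣ tabulate f ∣ ≡ ∑[ i < n ] χ (f i)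
∣tabulate∣≡∑χ f = trans (∣p∣≡∑χ (tabulate f)) (sum-cong-≗ (cong χ ∘ lookup∘tabulate f))

module _ {n : ℕ} {f : Fin n → Bool} {i : Fin n} where

  ∈-tabulate⁺ : f i ≡ true → i ∈ tabulate f
  ∈-tabulate⁺ fi = lookup⇒[]= i (tabulate f) (trans (lookup∘tabulate f i) fi)

  ∈-tabulate⁻ : i ∈ tabulate f → f i ≡ true
  ∈-tabulate⁻ i∈ = trans (sym (lookup∘tabulate f i)) ([]=⇒lookup i∈)

module _ {n : ℕ} where

  x∈p⇒0<∣p∣ : ∀ {p : Subset n} {x} → x ∈ p → 0 < ∣ p ∣
  x∈p⇒0<∣p∣ {p} {x} x∈p = subst (_≤ ∣ p ∣) (∣⁅x⁆∣≡1 x) (p⊆q⇒∣p∣≤∣q∣ ⁅x⁆⊆p)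
    where
    ⁅x⁆⊆p : ⁅ x ⁆ ⊆ p
    ⁅x⁆⊆p y∈⁅x⁆ = subst (_∈ p) (sym (x∈⁅y⁆⇒x≡y x y∈⁅x⁆)) x∈p

  x∈p∧y∈p∧x≢y⇒1<∣p∣ : ∀ {p : Subset n} {x y} → x ∈ p → y ∈ p → x ≢ y → 1 < ∣ p ∣
  x∈p∧y∈p∧x≢y⇒1<∣p∣ x∈p y∈p x≢y =
    ≤-<-trans (x∈p⇒0<∣p∣ (x∈p∧x≢y⇒x∈p-y y∈p (x≢y ∘ sym))) (x∈p⇒∣p-x∣<∣p∣ x∈p)

  Empty⇒∣p∣≡0 : ∀ {p : Subset n} → Empty p → ∣ p ∣ ≡ 0
  Empty⇒∣p∣≡0 empty = trans (cong ∣_∣ (Empty-unique empty)) (∣⊥∣≡0 n)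

  0<∣p∣⇒Nonempty : ∀ {p : Subset n} → 0 < ∣ p ∣ → Nonempty p
  0<∣p∣⇒Nonempty {p} 0<∣p∣ =
    decidable-stable (nonempty? p) (λ empty → <-irrefl (sym (Empty⇒∣p∣≡0 empty)) 0<∣p∣)

  unique⇒∣p∣≤1 : ∀ {p : Subset n} → (∀ {x y} → x ∈ p → y ∈ p → x ≡ y) → ∣ p ∣ ≤ 1
  unique⇒∣p∣≤1 {p} unique with nonempty? p
  ... | no empty = subst (_≤ 1) (sym (Empty⇒∣p∣≡0 empty)) z≤n
  ... | yes (x , x∈p) = subst (∣ p ∣ ≤_) (∣⁅x⁆∣≡1 x) (p⊆q⇒∣p∣≤∣q∣ p⊆⁅x⁆)
    where
    p⊆⁅x⁆ : p ⊆ ⁅ x ⁆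
    p⊆⁅x⁆ y∈p = subst (_∈ ⁅ x ⁆) (unique x∈p y∈p) (x∈⁅x⁆ x)

anyFin⁺ : ∀ {k} (f : Fin k → Bool) {i} → f i ≡ true → anyFin f ≡ true
anyFin⁺ f {zero}  fi rewrite fi = refl
anyFin⁺ f {suc i} fi with f zero
... | true  = refl
... | false = anyFin⁺ (f ∘ suc) fi

anyFin⁻ : ∀ {k} (f : Fin k → Bool) → anyFin f ≡ true → ∃[ i ] f i ≡ true
anyFin⁻ {suc k} f any with f zero in f0
... | true  = zero , f0
... | false with anyFin⁻ (f ∘ suc) any
... | i , fi = suc i , fi

∑χ≡χ∘anyFin : ∀ {k} (f : Fin k → Bool) → (∀ {i j} → f i ≡ true → f j ≡ true → i ≡ j) →
              ∑[ i < k ] χ (f i) ≡ χ (anyFin f)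
∑χ≡χ∘anyFin {zero}  f unique = refl
∑χ≡χ∘anyFin {suc k} f unique
  with f zero in f0 | ∑χ≡χ∘anyFin (f ∘ suc) (λ fi fj → Fin.suc-injective (unique fi fj))
... | false | ih = ih
... | true  | ih = cong suc (trans ih (cong χ rest-false))
  where
  rest-false : anyFin (f ∘ suc) ≡ false
  rest-false with anyFin (f ∘ suc) in any
  ... | false = refl
  ... | true with anyFin⁻ (f ∘ suc) any
  ... | i , fi with unique f0 fi
  ... | ()

∑∣column∣≡∣domain∣ : ∀ {m n} (P : Fin m → Fin n → Bool) →
                     (∀ {a t u} → P a t ≡ true → P a u ≡ true → t ≡ u) →
                     ∑[ t < n ] ∣ tabulate (λ a → P a t) ∣ ≡ ∣ tabulate (λ a → anyFin (P a)) ∣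
∑∣column∣≡∣domain∣ {m} {n} P functional = begin
  ∑[ t < n ] ∣ tabulate (λ a → P a t) ∣ ≡⟨ sum-cong-≗ (λ t → ∣tabulate∣≡∑χ (λ a → P a t)) ⟩
  ∑[ t < n ] ∑[ a < m ] χ (P a t)       ≡⟨ ∑-comm (λ t a → χ (P a t)) ⟩
  ∑[ a < m ] ∑[ t < n ] χ (P a t)       ≡⟨ sum-cong-≗ (λ a → ∑χ≡χ∘anyFin (P a) functional) ⟩
  ∑[ a < m ] χ (anyFin (P a))          ≡⟨ ∣tabulate∣≡∑χ (λ a → anyFin (P a)) ⟨
  ∣ tabulate (λ a → anyFin (P a)) ∣    ∎
  where open ≡-Reasoning

∑-mono-≤ : ∀ {k} {f g : Fin k → ℕ} → (∀ i → f i ≤ g i) → sum f ≤ sum g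
∑-mono-≤ {zero}  f≤g = z≤n
∑-mono-≤ {suc k} f≤g = +-mono-≤ (f≤g zero) (∑-mono-≤ (f≤g ∘ suc))

∑-mono-< : ∀ {k} {f g : Fin k → ℕ} → (∀ i → f i ≤ g i) → ∀ j → f j < g j → sum f < sum g
∑-mono-< f≤g zero    fj<gj = +-mono-<-≤ fj<gj (∑-mono-≤ (f≤g ∘ suc))
∑-mono-< f≤g (suc j) fj<gj = +-mono-≤-< (f≤g zero) (∑-mono-< (f≤g ∘ suc) j fj<gj)

module _ {a} {A : Set a} where

  infixl 5 _∷ʳ_
  _∷ʳ_ : ∀ {k} → Vector A k → A → Vector A (suc k)
  _∷ʳ_ {zero}  f x _       = x
  _∷ʳ_ {suc k} f x zero    = f zero
  _∷ʳ_ {suc k} f x (suc i) = (f ∘ suc ∷ʳ x) i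

  ∷ʳ-inject₁ : ∀ {k} (f : Vector A k) x i → (f ∷ʳ x) (inject₁ i) ≡ f i
  ∷ʳ-inject₁ {suc k} f x zero    = refl
  ∷ʳ-inject₁ {suc k} f x (suc i) = ∷ʳ-inject₁ (f ∘ suc) x i

  ∷ʳ-fromℕ : ∀ {k} (f : Vector A k) x → (f ∷ʳ x) (fromℕ k) ≡ x
  ∷ʳ-fromℕ {zero}  f x = refl
  ∷ʳ-fromℕ {suc k} f x = ∷ʳ-fromℕ (f ∘ suc) x

  ∷ʳ-∀ : ∀ {p k} (P : A → Set p) {f : Vector A k} {x} →
         (∀ i → P (f i)) → P x → ∀ j → P ((f ∷ʳ x) j)
  ∷ʳ-∀ P {f} {x} Pf Px j with view j
  ... | ‵fromℕ     = subst P (sym (∷ʳ-fromℕ f x)) Px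
  ... | ‵inject₁ i = subst P (sym (∷ʳ-inject₁ f x i)) (Pf i)

  ∷ʳ-injective : ∀ {k} {f : Vector A k} {x} →
                 Injective _≡_ _≡_ f → (∀ i → f i ≢ x) → Injective _≡_ _≡_ (f ∷ʳ x)
  ∷ʳ-injective {f = f} {x} f-inj f≢x {i} {j} eq with view i | view j
  ... | ‵inject₁ i | ‵inject₁ j =
    cong inject₁ (f-inj (trans (sym (∷ʳ-inject₁ f x i)) (trans eq (∷ʳ-inject₁ f x j))))
  ... | ‵inject₁ i | ‵fromℕ =
    contradiction (trans (sym (∷ʳ-inject₁ f x i)) (trans eq (∷ʳ-fromℕ f x))) (f≢x i)
  ... | ‵fromℕ | ‵inject₁ j =
    contradiction (trans (sym (∷ʳ-inject₁ f x j)) (trans (sym eq) (∷ʳ-fromℕ f x))) (f≢x j)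
  ... | ‵fromℕ | ‵fromℕ = refl

*<⇒<⌈/⌉ : ∀ {g d a} → 0 < g → g * d < a → d < ⌈ a / g ⌉
*<⇒<⌈/⌉ {suc k} {d} {a} _ gd<a = begin
  suc d                  ≡⟨ m*n/n≡m (suc d) (suc k) ⟨
  suc d * suc k / suc k  ≤⟨ /-monoˡ-≤ (suc k) bound ⟩
  (a + k) / suc k        ∎
  where
  open ≤-Reasoning
  bound : suc d * suc k ≤ a + k
  bound = begin
    suc d * suc k          ≡⟨ *-comm (suc d) (suc k) ⟩
    suc k * suc d          ≡⟨ *-suc (suc k) d ⟩
    suc (k + suc k * d)    ≡⟨ cong suc (+-comm k (suc k * d)) ⟩
    suc (suc k * d) + k    ≤⟨ +-monoˡ-≤ k gd<a ⟩
    a + k                  ∎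

m*[1+n*o]≤n*p⇒m*o<p : ∀ {m n o p} → 0 < m → m * suc (n * o) ≤ n * p → m * o < p
m*[1+n*o]≤n*p⇒m*o<p {m} {n} {o} {p} 0<m le = *-cancelˡ-< n (m * o) p (begin-strict
  n * (m * o)        <⟨ +-monoˡ-≤ (n * (m * o)) 0<m ⟩
  m + n * (m * o)    ≡⟨ cong (m +_) (x∙yz≈y∙xz m n o) ⟨
  m + m * (n * o)    ≡⟨ *-suc m (n * o) ⟨
  m * suc (n * o)    ≤⟨ le ⟩
  n * p              ∎)
  where open ≤-Reasoning

maxList-map-≤ : ∀ {A : Set} (f : A → ℕ) {c} (xs : List A) → (∀ x → f x ≤ c) → maxList (map f xs) ≤ c
maxList-map-≤ f []       f≤c = z≤n
maxList-map-≤ f (x ∷ xs) f≤c = ⊔-lub (f≤c x) (maxList-map-≤ f xs f≤c)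

module _ {m n} (E : BipGraph m n) {X : Subset m} where

  ∈Γ⁺ : ∀ {a b} → a ∈ X → E a b ≡ true → b ∈ Γ E X
  ∈Γ⁺ {b = b} a∈X eab =
    ∈-tabulate⁺ (anyFin⁺ (λ a → lookup X a ∧ E a b) (cong₂ _∧_ ([]=⇒lookup a∈X) eab))

  ∈Γ⁻ : ∀ {b} → b ∈ Γ E X → ∃[ a ] a ∈ X × E a b ≡ true
  ∈Γ⁻ {b} b∈ with anyFin⁻ (λ a → lookup X a ∧ E a b) (∈-tabulate⁻ b∈)
  ... | a , q = a , lookup⇒[]= a X (∧-conicalˡ _ _ q) , ∧-conicalʳ _ _ q

module SemiMatching {m n : ℕ} (E : BipGraph m n) (A' : Subset m) {S : EdgeSet m n}
                    (semi : IsSemiMatching E A' S) where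

  S⊆E : ∀ {a b} → S a b ≡ true → E a b ≡ true
  S⊆E = proj₁ semi _ _

  S⊆A' : ∀ {a b} → S a b ≡ true → a ∈ A'
  S⊆A' = proj₁ (proj₂ semi) _ _

  degA≡1 : ∀ {a} → a ∈ A' → degA S a ≡ 1
  degA≡1 = proj₂ (proj₂ semi) _

  S-functional : ∀ {a t u} → S a t ≡ true → S a u ≡ true → t ≡ u
  S-functional {t = t} {u} sat sau with t Fin.≟ u
  ... | yes t≡u = t≡u
  ... | no  t≢u = contradiction (x∈p∧y∈p∧x≢y⇒1<∣p∣ (∈-tabulate⁺ sat) (∈-tabulate⁺ sau) t≢u)
                                (<-irrefl (sym (degA≡1 (S⊆A' sat))))

  degA≤1 : ∀ a → degA S a ≤ 1
  degA≤1 a = unique⇒∣p∣≤1 (λ t∈ u∈ → S-functional (∈-tabulate⁻ t∈) (∈-tabulate⁻ u∈))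

  matched : ∀ {a} → a ∈ A' → ∃[ b ] S a b ≡ true
  matched a∈A' with 0<∣p∣⇒Nonempty (subst (0 <_) (sym (degA≡1 a∈A')) (s≤s z≤n))
  ... | b , b∈ = b , ∈-tabulate⁻ b∈

  0<∣Γ∣ : Nonempty A' → 0 < ∣ Γ E A' ∣
  0<∣Γ∣ (a , a∈A') = x∈p⇒0<∣p∣ (∈Γ⁺ E a∈A' (S⊆E (proj₂ (matched a∈A'))))

  record AltPath (s t : Fin n) : Set where
    field
      l      : ℕ
      bs     : Fin (suc l) → Fin n
      as     : Fin l → Fin m
      bs-inj : Injective _≡_ _≡_ bs
      as-inj : Injective _≡_ _≡_ as
      as∈A'  : (i : Fin l) → as i ∈ A'
      inS    : (i : Fin l) → S (as i) (bs (inject₁ i)) ≡ true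
      inE    : (i : Fin l) → E (as i) (bs (suc i)) ≡ true
      notS   : (i : Fin l) → S (as i) (bs (suc i)) ≡ false
      start  : bs zero ≡ s
      end    : bs (fromℕ l) ≡ t

  AltPath-refl : ∀ s → AltPath s s
  AltPath-refl s = record
    { l = 0 ; bs = λ _ → s ; as = λ () ; bs-inj = λ { {zero} {zero} _ → refl } ; as-inj = λ { {()} }
    ; as∈A' = λ () ; inS = λ () ; inE = λ () ; notS = λ () ; start = refl ; end = refl }

  toDegMinPath : ∀ {s t} → AltPath s t → degB S t + 2 ≤ degB S s → DegMinPath E A' S
  toDegMinPath P gap = record
    { AltPath P hiding (start; end)
    ; degGap = subst₂ (λ t s → degB S t + 2 ≤ degB S s) (sym end) (sym start) gap }
    where open AltPath P

  extend : ∀ {s t u a} (P : AltPath s t) → (∀ i → AltPath.bs P i ≢ u) →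
           S a t ≡ true → E a u ≡ true → AltPath s u
  extend {u = u} {a} P bs≢u sat eau = record
    { l = suc l ; bs = bs ∷ʳ u ; as = as ∷ʳ a
    ; bs-inj = ∷ʳ-injective bs-inj bs≢u ; as-inj = ∷ʳ-injective as-inj as≢a
    ; as∈A' = ∷ʳ-∀ (_∈ A') as∈A' (S⊆A' sat)
    ; inS = inS′ ; inE = inE′ ; notS = notS′ ; start = start ; end = ∷ʳ-fromℕ bs u }
    where
    open AltPath P
    -- each as i is matched to a vertex before t on the path, while a is matched to t
    as≢a : ∀ i → as i ≢ a
    as≢a i as≡a = Fin.fromℕ≢inject₁
      (sym (bs-inj (trans (S-functional (subst (λ x → S x _ ≡ true) as≡a (inS i)) sat) (sym end))))
    sau : S a u ≡ false
    sau = ¬-not (λ sau → bs≢u (fromℕ l) (trans end (S-functional sat sau)))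
    inS′ : ∀ j → S ((as ∷ʳ a) j) ((bs ∷ʳ u) (inject₁ j)) ≡ true
    inS′ j with view j
    ... | ‵inject₁ i rewrite ∷ʳ-inject₁ as a i | ∷ʳ-inject₁ bs u (inject₁ i) = inS i
    ... | ‵fromℕ rewrite ∷ʳ-fromℕ as a | ∷ʳ-inject₁ bs u (fromℕ l) | end = sat
    inE′ : ∀ j → E ((as ∷ʳ a) j) ((bs ∷ʳ u) (suc j)) ≡ true
    inE′ j with view j
    ... | ‵inject₁ i rewrite ∷ʳ-inject₁ as a i | ∷ʳ-inject₁ bs u (suc i) = inE i
    ... | ‵fromℕ rewrite ∷ʳ-fromℕ as a | ∷ʳ-fromℕ bs u = eau
    notS′ : ∀ j → S ((as ∷ʳ a) j) ((bs ∷ʳ u) (suc j)) ≡ false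
    notS′ j with view j
    ... | ‵inject₁ i rewrite ∷ʳ-inject₁ as a i | ∷ʳ-inject₁ bs u (suc i) = notS i
    ... | ‵fromℕ rewrite ∷ʳ-fromℕ as a | ∷ʳ-fromℕ bs u = sau

  Spanning : Fin n → Subset n → Set
  Spanning s R = ∀ {t} → t ∈ R → Σ[ P ∈ AltPath s t ] (∀ i → AltPath.bs P i ∈ R)

  Closed : Subset n → Set
  Closed R = ∀ {a t u} → t ∈ R → S a t ≡ true → E a u ≡ true → u ∈ R

  Exit : Subset n → Fin m → Fin n → Fin n → Set
  Exit R a t u = t ∈ R × S a t ≡ true × E a u ≡ true × u ∉ R

  exit? : ∀ R → Dec (∃[ a ] ∃[ t ] ∃[ u ] Exit R a t u)
  exit? R = any? λ a → any? λ t → any? λ u →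
    t ∈? R ×-dec S a t Bool.≟ true ×-dec E a u Bool.≟ true ×-dec ¬? (u ∈? R)

  ¬exit⇒closed : ∀ {R} → ¬ (∃[ a ] ∃[ t ] ∃[ u ] Exit R a t u) → Closed R
  ¬exit⇒closed {R} no-exit {a} {t} {u} t∈R sat eau =
    decidable-stable (u ∈? R) (λ u∉R → no-exit (a , t , u , t∈R , sat , eau , u∉R))

  spanning-∪ : ∀ {s R a t u} → Spanning s R → Exit R a t u → Spanning s (R ∪ ⁅ u ⁆)
  spanning-∪ {R = R} {u = u} span (t∈R , sat , eau , u∉R) x∈R∪u with x∈p∪q⁻ R ⁅ u ⁆ x∈R∪u
  ... | inj₁ x∈R = let P , P⊆R = span x∈R in P , p⊆p∪q ⁅ u ⁆ ∘ P⊆R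
  ... | inj₂ x∈⁅u⁆ rewrite x∈⁅y⁆⇒x≡y u x∈⁅u⁆ =
    let P , P⊆R = span t∈R
    in extend P (λ i bs≡u → u∉R (subst (_∈ R) bs≡u (P⊆R i))) sat eau ,
       ∷ʳ-∀ (_∈ R ∪ ⁅ u ⁆) (p⊆p∪q ⁅ u ⁆ ∘ P⊆R) (q⊆p∪q R ⁅ u ⁆ (x∈⁅x⁆ u))

  close : ∀ {s} R → Acc _⊃_ R → Spanning s R → Σ[ R′ ∈ Subset n ] R ⊆ R′ × Spanning s R′ × Closed R′
  close R (acc larger) span with exit? R
  ... | no no-exit = R , id , span , ¬exit⇒closed no-exit
  ... | yes (a , t , u , exit) =
    let R′ , R∪u⊆R′ , span′ , closed = close (R ∪ ⁅ u ⁆) (larger R⊂R∪u) (spanning-∪ span exit)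
    in R′ , R∪u⊆R′ ∘ p⊆p∪q ⁅ u ⁆ , span′ , closed
    where
    R⊂R∪u : R ⊂ R ∪ ⁅ u ⁆
    R⊂R∪u = p⊆p∪q ⁅ u ⁆ , u , q⊆p∪q R ⁅ u ⁆ (x∈⁅x⁆ u) , proj₂ (proj₂ (proj₂ exit))

  Spanning-⁅⁆ : ∀ s → Spanning s ⁅ s ⁆
  Spanning-⁅⁆ s t∈⁅s⁆ rewrite x∈⁅y⁆⇒x≡y s t∈⁅s⁆ = AltPath-refl s , λ _ → x∈⁅x⁆ s

  reachable : ∀ s → Σ[ R ∈ Subset n ] s ∈ R × Spanning s R × Closed R
  reachable s with close ⁅ s ⁆ (⊃-wellFounded ⁅ s ⁆) (Spanning-⁅⁆ s)
  ... | R , ⁅s⁆⊆R , span , closed = R , ⁅s⁆⊆R (x∈⁅x⁆ s) , span , closed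

  matchedInto : Subset n → Subset m
  matchedInto R = tabulate λ a → anyFin λ t → lookup R t ∧ S a t

  matchedInto⊆A' : ∀ {R} → matchedInto R ⊆ A'
  matchedInto⊆A' {R} {a} a∈ with anyFin⁻ (λ t → lookup R t ∧ S a t) (∈-tabulate⁻ a∈)
  ... | t , q = S⊆A' (∧-conicalʳ _ _ q)

  matchedInto-nonempty : ∀ {R s} → s ∈ R → 0 < degB S s → Nonempty (matchedInto R)
  matchedInto-nonempty {R} {s} s∈R 0<deg with 0<∣p∣⇒Nonempty 0<deg
  ... | a , a∈ = a , ∈-tabulate⁺ (anyFin⁺ (λ t → lookup R t ∧ S a t)
                                          (cong₂ _∧_ ([]=⇒lookup s∈R) (∈-tabulate⁻ a∈)))

  Γ-matchedInto⊆ : ∀ {R} → Closed R → Γ E (matchedInto R) ⊆ R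
  Γ-matchedInto⊆ {R} closed u∈Γ with ∈Γ⁻ E u∈Γ
  ... | a , a∈ , eau with anyFin⁻ (λ t → lookup R t ∧ S a t) (∈-tabulate⁻ a∈)
  ... | t , q = closed (lookup⇒[]= t R (∧-conicalˡ _ _ q)) (∧-conicalʳ _ _ q) eau

  ∣matchedInto∣≡∑ : ∀ R → ∣ matchedInto R ∣ ≡ ∑[ t < n ] ∣ tabulate (λ a → lookup R t ∧ S a t) ∣
  ∣matchedInto∣≡∑ R = sym (∑∣column∣≡∣domain∣ (λ a t → lookup R t ∧ S a t)
                            (λ p q → S-functional (∧-conicalʳ _ _ p) (∧-conicalʳ _ _ q)))

  module _ (optimal : ¬ DegMinPath E A' S) where

    degB-reachable : ∀ {s R t} → Spanning s R → t ∈ R → degB S s ≤ suc (degB S t)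
    degB-reachable {s} {t = t} span t∈R = ≮⇒≥ λ gap →
      optimal (toDegMinPath (proj₁ (span t∈R)) (subst (_≤ degB S s) (+-comm 2 (degB S t)) gap))

    ∣R∣*d<∣matchedInto∣ : ∀ {s R d} → degB S s ≡ suc d → s ∈ R → Spanning s R →
                          ∣ R ∣ * d < ∣ matchedInto R ∣
    ∣R∣*d<∣matchedInto∣ {s} {R} {d} degs s∈R span = begin-strict
      ∣ R ∣ * d                                          ≡⟨ cong (_* d) (∣p∣≡∑χ R) ⟩
      (∑[ t < n ] χ (lookup R t)) * d                    ≡⟨ *-distribʳ-sum d (χ ∘ lookup R) ⟩
      ∑[ t < n ] (χ (lookup R t) * d)                    <⟨ ∑-mono-< lower s at-s ⟩
      ∑[ t < n ] ∣ tabulate (λ a → lookup R t ∧ S a t) ∣ ≡⟨ ∣matchedInto∣≡∑ R ⟨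
      ∣ matchedInto R ∣                                  ∎
      where
      open ≤-Reasoning
      lower : ∀ t → χ (lookup R t) * d ≤ ∣ tabulate (λ a → lookup R t ∧ S a t) ∣
      lower t with lookup R t in t∈R
      ... | false = z≤n
      ... | true  = ≤-trans (≤-reflexive (*-identityˡ d))
                      (s≤s⁻¹ (subst (_≤ _) degs (degB-reachable span (lookup⇒[]= t R t∈R))))
      at-s : χ (lookup R s) * d < ∣ tabulate (λ a → lookup R s ∧ S a s) ∣
      at-s rewrite []=⇒lookup s∈R = subst (d + 0 <_) (sym degs) (s≤s (≤-reflexive (+-identityʳ d)))

    degB-bound : ∀ {g α} → 0 < g →
                 ((A'' : Subset m) → A'' ⊆ A' → Nonempty A'' → g * ∣ A'' ∣ ≤ ∣ Γ E A'' ∣ * α) →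
                 ∀ {s d} → degB S s ≡ suc d → g * d < α
    degB-bound {g} {α} 0<g ratio {s} {d} degs with reachable s
    ... | R , s∈R , span , closed = m*[1+n*o]≤n*p⇒m*o<p {n = ∣ R ∣} 0<g (begin
      g * suc (∣ R ∣ * d)         ≤⟨ *-monoʳ-≤ g (∣R∣*d<∣matchedInto∣ {R = R} degs s∈R span) ⟩
      g * ∣ matchedInto R ∣       ≤⟨ ratio (matchedInto R) (matchedInto⊆A' {R}) nonempty ⟩
      ∣ Γ E (matchedInto R) ∣ * α ≤⟨ *-monoˡ-≤ α (p⊆q⇒∣p∣≤∣q∣ (Γ-matchedInto⊆ closed)) ⟩
      ∣ R ∣ * α                   ∎)
      where
      open ≤-Reasoning
      nonempty : Nonempty (matchedInto R)
      nonempty = matchedInto-nonempty s∈R (subst (0 <_) (sym degs) (s≤s z≤n))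

lemma3 : {m n : ℕ} (E : BipGraph m n) (A' : Subset m)
  → Nonempty A'
  → ∣ Γ E A' ∣ ≤ ∣ A' ∣
  → ((A'' : Subset m) → A'' ⊆ A' → Nonempty A''
      → ∣ Γ E A' ∣ * ∣ A'' ∣ ≤ ∣ Γ E A'' ∣ * ∣ A' ∣)
  → (S : EdgeSet m n) → IsOptimalSemiMatching E A' S
  → degMax S ≤ ⌈ ∣ A' ∣ / ∣ Γ E A' ∣ ⌉
lemma3 {m} {n} E A' A'-nonempty _ ratio S (semi , optimal) =
  ⊔-lub (maxList-map-≤ (degA S) (allFin m) (λ a → ≤-trans (degA≤1 a) 0<⌈α/g⌉))
        (maxList-map-≤ (degB S) (allFin n) degB≤⌈α/g⌉)
  where
  open SemiMatching E A' semi
  0<g : 0 < ∣ Γ E A' ∣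
  0<g = 0<∣Γ∣ A'-nonempty
  0<⌈α/g⌉ : 0 < ⌈ ∣ A' ∣ / ∣ Γ E A' ∣ ⌉
  0<⌈α/g⌉ = *<⇒<⌈/⌉ 0<g
    (subst (_< ∣ A' ∣) (sym (*-zeroʳ ∣ Γ E A' ∣)) (x∈p⇒0<∣p∣ (proj₂ A'-nonempty)))
  degB≤⌈α/g⌉ : ∀ b → degB S b ≤ ⌈ ∣ A' ∣ / ∣ Γ E A' ∣ ⌉
  degB≤⌈α/g⌉ b with degB S b in degb
  ... | zero  = z≤n
  ... | suc d = *<⇒<⌈/⌉ 0<g (degB-bound optimal 0<g ratio degb)
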